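{- Let $\mathcal{T}=(X,\leq_{\mathcal{T}})$, $\mathcal{S}=(Y,\leq_{\mathcal{S}})$, $\mathcal{U}=(Z,\leq_{\mathcal{U}})$ be three connected finite topological spaces on pairwise disjoint sets, and let $s\in Y$, $u\in Z$. Then $$\mathcal{T}\nearrow^s(\mathcal{S}\searrow_u\mathcal{U})=\Psi_{X,Z}\big((\mathcal{T}\nearrow^s\mathcal{S})\searrow_u\mathcal{U}\big),$$ and this is a connected topology on $X\sqcup Y\sqcup Z$ (i.e. the diagram $\Psi_{X,Z}\circ\searrow_u\circ(\nearrow^s\otimes\mathrm{id})=\nearrow^s\circ(\mathrm{id}\otimes\searrow_u)$ from $\mathbb{V}_X\otimes\mathbb{V}_Y\otimes\mathbb{V}_Z$ to $\mathbb{V}_{X\sqcup Y\sqcup Z}$ commutes).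
   Context: A finite topological space is a finite set with a preorder (open sets = upper sets); $\mathbb{V}_X$ is the vector space spanned by connected topologies on $X$. For spaces $\mathcal{A}=(A,\leq_{\mathcal{A}})$, $\mathcal{B}=(B,\leq_{\mathcal{B}})$ on disjoint sets and $v\in B$: $\mathcal{A}\searrow_v\mathcal{B}=(A\sqcup B,\leq)$ with $x\leq y$ iff ($x,y\in A$, $x\leq_{\mathcal{A}}y$) or ($x,y\in B$, $x\leq_{\mathcal{B}}y$) or ($x\in B$, $y\in A$, $x\leq_{\mathcal{B}}v$). Let $j$ be the involution reversing the preorder ($\leq$ becomes $\geq$). Define $\mathcal{A}\nearrow^v\mathcal{B}=j\big(j(\mathcal{A})\searrow_v j(\mathcal{B})\big)$; explicitly $x\leq y$ iff ($x,y\in A$, $x\leq_{\mathcal{A}}y$) or ($x,y\in B$, $x\leq_{\mathcal{B}}y$) or ($x\in A$, $y\in B$, $v\leq_{\mathcal{B}}y$). For a topology $\mathcal{W}$ on a finite set $W$ and disjoint $W_1,W_2\subset W$, $\Psi_{W_1,W_2}(\mathcal{W})$ is the relation on $W$ in which any $a\in W_1$ and $b\in W_2$ are incomparable (in both orders), and otherwise $a\leq b$ iff $a\leq_{\mathcal{W}}b$. -}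

module Defs where

open import Data.Nat using (ℕ)
open import Level using (0ℓ)
open import Data.Fin using (Fin)
open import Data.Sum using (_⊎_; inj₁; inj₂)
open import Data.Product using (_×_)
open import Data.Empty using (⊥)
open import Data.Unit using (⊤)
open import Relation.Nullary using (¬_)
open import Relation.Binary.Core using (Rel)
open import Relation.Binary.Structures using (IsPreorder)
open import Relation.Binary.PropositionalEquality using (_≡_)
open import Relation.Binary.Construct.Closure.Equivalence using (EqClosure)

-- A topology on a (finite) carrier W is a preorder on W
-- (open sets = upper sets); we encode it by its relation.
IsTopology : {W : Set} → Rel W 0ℓ → Set
IsTopology R = IsPreorder _≡_ R

IsConnected : {W : Set} → Rel W 0ℓ → Set
IsConnected {W} R = (x y : W) → EqClosure R x y

IsConnectedTopology : {W : Set} → Rel W 0ℓ → Set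
IsConnectedTopology R = IsTopology R × IsConnected R

record FinTop (n : ℕ) : Set₁ where
  field
    _≤_        : Rel (Fin n) 0ℓ
    isTopology : IsTopology _≤_

j : {W : Set} → Rel W 0ℓ → Rel W 0ℓ
j R x y = R y x

infixr 5 _↘[_]_
_↘[_]_ : {A B : Set} → Rel A 0ℓ → B → Rel B 0ℓ → Rel (A ⊎ B) 0ℓ
(R ↘[ v ] S) (inj₁ x) (inj₁ y) = R x y
(R ↘[ v ] S) (inj₂ x) (inj₂ y) = S x y
(R ↘[ v ] S) (inj₂ x) (inj₁ y) = S x v
(R ↘[ v ] S) (inj₁ x) (inj₂ y) = ⊥

infixr 5 _↗[_]_
_↗[_]_ : {A B : Set} → Rel A 0ℓ → B → Rel B 0ℓ → Rel (A ⊎ B) 0ℓ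
R ↗[ v ] S = j (j R ↘[ v ] j S)

Ψ : {W : Set} → (W → Set) → (W → Set) → Rel W 0ℓ → Rel W 0ℓ
Ψ W₁ W₂ R a b = R a b × ¬ (W₁ a × W₂ b) × ¬ (W₂ a × W₁ b)

inX : {X Y Z : Set} → (X ⊎ Y) ⊎ Z → Set
inX (inj₁ (inj₁ _)) = ⊤
inX (inj₁ (inj₂ _)) = ⊥
inX (inj₂ _)        = ⊥

inZ : {X Y Z : Set} → (X ⊎ Y) ⊎ Z → Set
inZ (inj₁ _) = ⊥
inZ (inj₂ _) = ⊤

{-# OPTIONS --safe #-}
module Submission where

-- Both sides of the identity compare two points by the same recipe except for a point of Z
-- below a point of X: on the left this never happens, on the right Ψ removes it.  The topology
-- part holds because ↘ and ↗ = j ∘ ↘ ∘ (j ⊗ j) preserve preorders, and connectedness because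
-- every point of A ⊔ B is comparable with v in A ↘_v B once B is connected.

open import Defs
open import Data.Nat using (ℕ)
open import Data.Fin using (Fin)
open import Data.Sum using (_⊎_; inj₁; inj₂; assocˡ)
open import Data.Product using (_×_; _,_; proj₁; uncurry)
open import Data.Empty using (⊥-elim)
open import Data.Unit using (tt)
open import Function.Base using (_∘_; id)
open import Function.Bundles using (_⇔_; mk⇔)
open import Function.Properties.Equivalence using () renaming (sym to ⇔-sym)
open import Level using (0ℓ)
open import Relation.Nullary using (¬_)
open import Relation.Binary.Core using (Rel)
open import Relation.Binary.Definitions using (Reflexive; Transitive)
open import Relation.Binary.Structures using (IsPreorder)
open import Relation.Binary.PropositionalEquality using (_≡_; refl)
open import Relation.Binary.PropositionalEquality.Properties using (isEquivalence)
import Relation.Binary.Construct.Flip.EqAndOrd as Flip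
open import Relation.Binary.Construct.Closure.Equivalence as EC using (EqClosure)
open import Relation.Binary.Construct.Closure.ReflexiveTransitive using (_◅_; ε)
open import Relation.Binary.Construct.Closure.Symmetric using (bwd)

private
  variable
    A B C : Set

isConnected-fromBasePoint : {Q : Rel A 0ℓ} {o : A} → (∀ x → EqClosure Q x o) → IsConnected Q
isConnected-fromBasePoint {Q = Q} toO x y = EC.transitive Q (toO x) (EC.symmetric Q (toO y))

module _ {R : Rel A 0ℓ} {S : Rel B 0ℓ} {v : B} where

  ↘-reflexive : Reflexive R → Reflexive S → Reflexive (R ↘[ v ] S)
  ↘-reflexive reflR reflS {inj₁ _} = reflR
  ↘-reflexive reflR reflS {inj₂ _} = reflS

  ↘-trans : Transitive R → Transitive S → Transitive (R ↘[ v ] S)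
  ↘-trans transR transS {inj₁ _} {inj₁ _} {inj₁ _} p q = transR p q
  ↘-trans transR transS {inj₁ _} {inj₁ _} {inj₂ _} p ()
  ↘-trans transR transS {inj₁ _} {inj₂ _} {_}      () q
  ↘-trans transR transS {inj₂ _} {inj₁ _} {inj₁ _} p q = p
  ↘-trans transR transS {inj₂ _} {inj₁ _} {inj₂ _} p ()
  ↘-trans transR transS {inj₂ _} {inj₂ _} {inj₁ _} p q = transS p q
  ↘-trans transR transS {inj₂ _} {inj₂ _} {inj₂ _} p q = transS p q

  ↘-isPreorder : IsPreorder _≡_ R → IsPreorder _≡_ S → IsPreorder _≡_ (R ↘[ v ] S)
  ↘-isPreorder preR preS = record
    { isEquivalence = isEquivalence
    ; reflexive     = λ { {x} refl → ↘-reflexive R.refl S.refl {x} }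
    ; trans         = λ {x y z} → ↘-trans R.trans S.trans {x} {y} {z}
    }
    where
      module R = IsPreorder preR
      module S = IsPreorder preS

  ↘-isConnected : Reflexive S → IsConnected S → IsConnected (R ↘[ v ] S)
  ↘-isConnected reflS connS = isConnected-fromBasePoint toV
    where
      toV : ∀ w → EqClosure (R ↘[ v ] S) w (inj₂ v)
      toV (inj₁ x) = bwd reflS ◅ ε
      toV (inj₂ y) = EC.gmap inj₂ id (connS y v)

j-isPreorder : {Q : Rel A 0ℓ} → IsPreorder _≡_ Q → IsPreorder _≡_ (j Q)
j-isPreorder = Flip.isPreorder

j-isConnected : {Q : Rel A 0ℓ} → IsConnected Q → IsConnected (j Q)
j-isConnected {Q = Q} connQ x y =
  EC.fold (EC.isEquivalence (j Q)) (EC.symmetric (j Q) ∘ EC.return) (connQ x y)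

module _ {R : Rel A 0ℓ} {S : Rel B 0ℓ} {v : B} where

  ↗-isPreorder : IsPreorder _≡_ R → IsPreorder _≡_ S → IsPreorder _≡_ (R ↗[ v ] S)
  ↗-isPreorder preR preS = j-isPreorder (↘-isPreorder (j-isPreorder preR) (j-isPreorder preS))

  ↗-isConnected : Reflexive S → IsConnected S → IsConnected (R ↗[ v ] S)
  ↗-isConnected reflS connS = j-isConnected (↘-isConnected {R = j R} reflS (j-isConnected connS))

Ψ-unconstrained : (W₁ W₂ : A → Set) (Q : Rel A 0ℓ) (a b : A)
  → (W₁ a → ¬ W₂ b) → (W₂ a → ¬ W₁ b) → Ψ W₁ W₂ Q a b ⇔ Q a b
Ψ-unconstrained _ _ _ _ _ ¬W₁W₂ ¬W₂W₁ = mk⇔ proj₁ (λ q → q , uncurry ¬W₁W₂ , uncurry ¬W₂W₁)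

module _ (R : Rel A 0ℓ) (S : Rel B 0ℓ) (Q : Rel C 0ℓ) (s : B) (u : C) where

  private
    RSQ : Rel ((A ⊎ B) ⊎ C) 0ℓ
    RSQ = (R ↗[ s ] S) ↘[ u ] Q

    unconstrained : (a b : A ⊎ (B ⊎ C))
      → (inX (assocˡ a) → ¬ inZ (assocˡ b)) → (inZ (assocˡ a) → ¬ inX (assocˡ b))
      → RSQ (assocˡ a) (assocˡ b) ⇔ Ψ inX inZ RSQ (assocˡ a) (assocˡ b)
    unconstrained a b ¬XZ ¬ZX = ⇔-sym (Ψ-unconstrained inX inZ RSQ (assocˡ a) (assocˡ b) ¬XZ ¬ZX)

  ↗↘-interchange : (a b : A ⊎ (B ⊎ C))
    → (R ↗[ inj₁ s ] (S ↘[ u ] Q)) a b ⇔ Ψ inX inZ RSQ (assocˡ a) (assocˡ b)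
  ↗↘-interchange (inj₁ _)          (inj₂ (inj₂ _))   = mk⇔ ⊥-elim proj₁
  ↗↘-interchange (inj₂ (inj₂ _))   (inj₁ _)          =
    mk⇔ ⊥-elim λ (_ , _ , separated) → separated (tt , tt)
  ↗↘-interchange a@(inj₁ _)        b@(inj₁ _)        = unconstrained a b (λ _ ()) λ ()
  ↗↘-interchange a@(inj₁ _)        b@(inj₂ (inj₁ _)) = unconstrained a b (λ _ ()) λ ()
  ↗↘-interchange a@(inj₂ (inj₁ _)) b@(inj₁ _)        = unconstrained a b (λ ()) λ ()
  ↗↘-interchange a@(inj₂ (inj₁ _)) b@(inj₂ (inj₁ _)) = unconstrained a b (λ ()) λ ()
  ↗↘-interchange a@(inj₂ (inj₁ _)) b@(inj₂ (inj₂ _)) = unconstrained a b (λ ()) λ ()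
  ↗↘-interchange a@(inj₂ (inj₂ _)) b@(inj₂ (inj₁ _)) = unconstrained a b (λ ()) λ _ ()
  ↗↘-interchange a@(inj₂ (inj₂ _)) b@(inj₂ (inj₂ _)) = unconstrained a b (λ ()) λ _ ()

mainTheorem6 : {n m k : ℕ} (T : FinTop n) (S : FinTop m) (U : FinTop k)
    → IsConnected (FinTop._≤_ T) → IsConnected (FinTop._≤_ S) → IsConnected (FinTop._≤_ U)
    → (s : Fin m) (u : Fin k)
    → ((a b : Fin n ⊎ (Fin m ⊎ Fin k))
        → (FinTop._≤_ T ↗[ inj₁ s ] (FinTop._≤_ S ↘[ u ] FinTop._≤_ U)) a b
          ⇔ Ψ inX inZ ((FinTop._≤_ T ↗[ s ] FinTop._≤_ S) ↘[ u ] FinTop._≤_ U) (assocˡ a) (assocˡ b))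
      × IsConnectedTopology (FinTop._≤_ T ↗[ inj₁ s ] (FinTop._≤_ S ↘[ u ] FinTop._≤_ U))
mainTheorem6 T S U _ _ connU s u =
  ↗↘-interchange (_≤_ T) (_≤_ S) (_≤_ U) s u ,
  ↗-isPreorder (isTopology T) S↘U-isPreorder ,
  ↗-isConnected (λ {x} → IsPreorder.refl S↘U-isPreorder {x})
    (↘-isConnected (IsPreorder.refl (isTopology U)) connU)
  where
    open FinTop
    S↘U-isPreorder : IsPreorder _≡_ (_≤_ S ↘[ u ] _≤_ U)
    S↘U-isPreorder = ↘-isPreorder (isTopology S) (isTopology U)
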